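{- Given an incremental dynamic algorithm with worst-case update time $\Gamma_u$, the following procedure has amortized update time at most $O(\Gamma_u\cdot\log(T))$. Let $m=\lceil \log_2 T\rceil$ and initialize buckets $B_0=\dots=B_m=\emptyset$. For each update $t=1,\dots,T$: (1) rewind the incremental algorithm's computation to the state obtained by inserting $B_m, B_{m-1},\dots,B_{k(t)+2}$; (2) add the inserted element to $B_0$, or remove the deleted element from $B_0$; (3) let $B = B_0\cup\dots\cup B_{k(t)+1}$, set $B_i$ to be the set of the $2^i$-th through $(2^{i+1}-1)$-th youngest elements of $B$ for each $i\in[0:k(t)]$, and set $B_{k(t)+1} = B\setminus(B_0\cup\dots\cup B_{k(t)})$; (4) call Insert on the elements of $B_{k(t)+1}, B_{k(t)},\dots,B_0$ in this order.
   Context: Setting: a sequence of $T$ updates (insertions and deletions of elements) in the deletions-look-ahead model, i.e. the relative order in which current elements will be deleted is known. An element $e_1$ is younger than $e_2$ if $e_1$ will be deleted earlier than $e_2$. For $t\in[T]$, $k(t)$ is the largest integer such that $t$ is a multiple of $2^{k(t)}$. Computation is in the RAM model, where rewinding is implemented by reversible computation (recording changes to memory cells), so that rewinding costs the same as the corresponding forward computation. Insert is the insertion procedure of the incremental algorithm (cost $O(\Gamma_u)$ each); adding/removing elements to the bucket sets costs $O(1)$. Amortized update time $X$ means total time over the $T$ updates is at most $T\cdot X$. -}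

module Defs where

open import Data.Nat using (ℕ; zero; suc; _+_; _*_; _∸_; _^_; _≤_; _≤ᵇ_; _≡ᵇ_)
open import Data.Nat.DivMod using (_%_; _/_)
open import Data.Bool using (Bool; true; false; if_then_else_)
open import Data.List using (List; []; _∷_; _++_; length; take; drop; concat; map; sum; upTo; reverse)
open import Data.Product using (_×_; _,_; proj₁; proj₂)

-- An element is identified by a natural number key which encodes its
-- position in the (known) deletion order: a smaller key means the element
-- is deleted earlier, i.e. it is YOUNGER.  An update either inserts an
-- element (with its key) or deletes an element; in the deletions-look-ahead
-- model the deleted element is always the youngest current one.

data Update : Set where
  ins : ℕ → Update
  del : Update

insKeys : List Update → List ℕ
insKeys []            = []
insKeys (ins e ∷ us)  = e ∷ insKeys us
insKeys (del ∷ us)    = insKeys us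

record IncAlg : Set₁ where
  field
    State  : Set
    init   : State
    insert : State → ℕ → State
    cost   : State → ℕ → ℕ

-- k(t): the largest k such that 2^k divides t (t ≥ 1).

kAux : ℕ → ℕ → ℕ
kAux zero       n = zero
kAux (suc fuel) n =
  if (n % 2 ≡ᵇ 0) ∧' (1 ≤ᵇ n) then suc (kAux fuel (n / 2)) else zero
  where
  _∧'_ : Bool → Bool → Bool
  true ∧' b = b
  false ∧' _ = false

kOf : ℕ → ℕ
kOf t = kAux t t

insertSorted : ℕ → List ℕ → List ℕ
insertSorted x []       = x ∷ []
insertSorted x (y ∷ ys) = if x ≤ᵇ y then x ∷ y ∷ ys else y ∷ insertSorted x ys

sortYoung : List ℕ → List ℕ
sortYoung []       = []
sortYoung (x ∷ xs) = insertSorted x (sortYoung xs)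

-- The computation of the incremental algorithm is recorded reversibly as a
-- log (most recent first) of Insert calls: (bucket index the inserted element
-- belonged to, state before the call, cost of the call).  Rewinding an Insert
-- call restores the state before it and costs as much as the call did.

module Procedure (A : IncAlg) where
  open IncAlg A

  LogEntry : Set
  LogEntry = ℕ × (State × ℕ)

  record Config : Set where
    constructor config
    field
      buckets : ℕ → List ℕ
      state   : State
      log     : List LogEntry
      spent   : ℕ

  initConfig : Config
  initConfig = config (λ _ → []) init [] 0

  -- Step 1: undo (in reverse order) all Insert calls made on elements of
  -- buckets with index ≤ j, i.e. rewind to the state obtained by inserting
  -- B_m, ..., B_{j+1}.
  rewind : ℕ → State → List LogEntry → State × (List LogEntry × ℕ)
  rewind j s [] = s , ([] , 0)
  rewind j s ((i , (s₀ , c)) ∷ l) with i ≤ᵇ j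
  ... | true  = let r = rewind j s₀ l in
                proj₁ r , (proj₁ (proj₂ r) , c + proj₂ (proj₂ r))
  ... | false = s , ((i , (s₀ , c)) ∷ l , 0)

  removeYoungest : List ℕ → List ℕ
  removeYoungest xs with sortYoung xs
  ... | []     = []
  ... | _ ∷ ys = ys

  step2 : Update → List ℕ → List ℕ
  step2 (ins e) b0 = e ∷ b0
  step2 del     b0 = removeYoungest b0

  setB : ℕ → List ℕ → (ℕ → List ℕ) → (ℕ → List ℕ)
  setB i xs f j = if i ≡ᵇ j then xs else f j

  unionUpTo : ℕ → (ℕ → List ℕ) → List ℕ
  unionUpTo n f = concat (map f (upTo (suc n)))

  redistribute : ℕ → List ℕ → (ℕ → List ℕ) → (ℕ → List ℕ)
  redistribute k L f j =
    if j ≤ᵇ k then drop (2 ^ j ∸ 1) (take (2 ^ (suc j) ∸ 1) L)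
    else if j ≡ᵇ suc k then drop (2 ^ (suc k) ∸ 1) L
    else f j

  insertBucket : ℕ → List ℕ → State → List LogEntry → State × (List LogEntry × ℕ)
  insertBucket i []       s l = s , (l , 0)
  insertBucket i (e ∷ es) s l =
    let r = insertBucket i es (insert s e) ((i , (s , cost s e)) ∷ l) in
    proj₁ r , (proj₁ (proj₂ r) , cost s e + proj₂ (proj₂ r))

  insertDown : ℕ → (ℕ → List ℕ) → State → List LogEntry → State × (List LogEntry × ℕ)
  insertDown zero    f s l = insertBucket zero (f zero) s l
  insertDown (suc n) f s l =
    let r₁ = insertBucket (suc n) (f (suc n)) s l
        r₂ = insertDown n f (proj₁ r₁) (proj₁ (proj₂ r₁)) in
    proj₁ r₂ , (proj₁ (proj₂ r₂) , proj₂ (proj₂ r₁) + proj₂ (proj₂ r₂))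

  -- One update at time t (t ≥ 1).  Time charged: rewinding cost + 1 for
  -- step 2 + (|B| + k(t) + 2) bucket operations for step 3 + Insert costs
  -- + (k(t) + 2) loop overhead for step 4.
  step : ℕ → Update → Config → Config
  step t u (config bs s l sp) =
    let k   = kOf t
        r₁  = rewind (suc k) s l
        bs₂ = setB 0 (step2 u (bs 0)) bs
        L   = sortYoung (unionUpTo (suc k) bs₂)
        bs₃ = redistribute k L bs₂
        r₄  = insertDown (suc k) bs₃ (proj₁ r₁) (proj₁ (proj₂ r₁))
    in config bs₃ (proj₁ r₄) (proj₁ (proj₂ r₄))
         (sp + proj₂ (proj₂ r₁) + 1 + (length L + k + 2)
             + proj₂ (proj₂ r₄) + (k + 2))

  runFrom : ℕ → List Update → Config → Config
  runFrom t []       c = c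
  runFrom t (u ∷ us) c = runFrom (suc t) us (step t u c)

  totalTime : List Update → ℕ
  totalTime us = Config.spent (runFrom 1 us initConfig)

module Submission where

-- Update t rebuilds the buckets B_0, …, B_{k+1} (k = k(t)); by an invariant they hold at most
-- 2^{k+3} elements, so the rebuild, together with the later rewinding of the Insert calls it makes
-- (prepaid as the costs recorded in the log), takes O(Γ_u 2^k) time.  The potential
-- Φ t M = Σ_{j<M} (t mod 2^j) of an M-digit binary counter changes by M + 1 − 2^{k+1} at update t,
-- so once M > k(t) for every t ≤ T, i.e. for M = ⌈log₂ T⌉ + 1, each update costs O(Γ_u (M + 1))
-- amortised.

open import Defs
open import Data.Bool using (true; false; T)
open import Data.List using (List; []; _∷_; [_]; _++_; length; take; drop; concat; map; upTo)
open import Data.List.Properties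
  using (length-++; length-take; take-take; take++drop≡id; map-++; concat-++; applyUpTo-∷ʳ; ++-identityʳ)
open import Data.List.Relation.Unary.Unique.Propositional using (Unique)
open import Data.Nat
open import Data.Nat.DivMod
open import Data.Nat.Divisibility
open import Data.Nat.Logarithm using (⌈log₂_⌉; ⌈log₂⌉-mono-≤; ⌈log₂2^n⌉≡n)
open import Data.Nat.Properties
open import Data.Nat.Tactic.RingSolver
open import Algebra.Properties.CommutativeSemigroup +-commutativeSemigroup using (xy∙z≈xz∙y)
open import Data.Product using (_×_; _,_; proj₁; proj₂; ∃-syntax)
open import Data.Sum using (inj₁; inj₂)
open import Function using (id; _∘_)
open import Relation.Nullary using (contradiction; yes; no)
open import Relation.Binary.PropositionalEquality
  using (_≡_; refl; sym; trans; cong; cong₂; subst; ≢-sym; module ≡-Reasoning)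

^-monoʳ-∣ : ∀ m {j k} → j ≤ k → m ^ j ∣ m ^ k
^-monoʳ-∣ m {k = k} z≤n = 1∣ (m ^ k)
^-monoʳ-∣ m (s≤s j≤k) = *-monoʳ-∣ m (^-monoʳ-∣ m j≤k)

[1+m]%n≡[1+m%n]%n : ∀ m n .{{_ : NonZero n}} → suc m % n ≡ suc (m % n) % n
[1+m]%n≡[1+m%n]%n m n =
  trans (%-congˡ (cong suc (m≡m%n+[m/n]*n m n))) ([m+kn]%n≡m%n (suc (m % n)) (m / n) n)

∣1+m⇒1+m%n≡n : ∀ m n .{{_ : NonZero n}} → n ∣ suc m → suc (m % n) ≡ n
∣1+m⇒1+m%n≡n m n n∣1+m with m≤n⇒m<n∨m≡n (m%n<n m n)
... | inj₂ 1+m%n≡n = 1+m%n≡n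
... | inj₁ 1+m%n<n = contradiction
  (trans ([1+m]%n≡[1+m%n]%n m n) (m<n⇒m%n≡m 1+m%n<n))
  (≢-sym 1+n≢0 ∘ trans (sym (n∣m⇒m%n≡0 (suc m) n n∣1+m)))

∤1+m⇒[1+m]%n≡1+m%n : ∀ m n .{{_ : NonZero n}} → n ∤ suc m → suc m % n ≡ suc (m % n)
∤1+m⇒[1+m]%n≡1+m%n m n n∤1+m with m≤n⇒m<n∨m≡n (m%n<n m n)
... | inj₁ 1+m%n<n = trans ([1+m]%n≡[1+m%n]%n m n) (m<n⇒m%n≡m 1+m%n<n)
... | inj₂ 1+m%n≡n = contradiction
  (m%n≡0⇒n∣m (suc m) n (trans ([1+m]%n≡[1+m%n]%n m n) (trans (%-congˡ 1+m%n≡n) (n%n≡0 n)))) n∤1+m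

kAux-exact : ∀ fuel n → 1 ≤ n → n ≤ fuel → 2 ^ kAux fuel n ∣ n × 2 ^ suc (kAux fuel n) ∤ n
kAux-exact zero    n       1≤n n≤0   = contradiction (≤-trans 1≤n n≤0) λ ()
kAux-exact (suc f) (suc m) _   n≤1+f with suc m % 2 ≡ᵇ 0 in parity
... | false = 1∣ suc m , λ 2∣n → subst T parity (≡⇒≡ᵇ _ 0 (n∣m⇒m%n≡0 (suc m) 2 2∣n))
... | true  = subst (λ n → 2 ^ suc k ∣ n × 2 ^ suc (suc k) ∤ n) 2h≡n
                (*-monoʳ-∣ 2 (proj₁ ih) , proj₂ ih ∘ *-cancelˡ-∣ 2)
  where
  h : ℕ
  h = suc m / 2
  2h≡n : 2 * h ≡ suc m
  2h≡n = m*[n/m]≡n (m%n≡0⇒n∣m (suc m) 2 (≡ᵇ⇒≡ _ 0 (subst T (sym parity) _)))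
  k : ℕ
  k = kAux f h
  ih : 2 ^ k ∣ h × 2 ^ suc k ∤ h
  ih = kAux-exact f h (n≢0⇒n>0 λ h≡0 → 1+n≢0 (trans (sym 2h≡n) (cong (2 *_) h≡0)))
                      (≤-pred (≤-trans (m/n<m (suc m) 2 (s≤s (s≤s z≤n))) n≤1+f))

2^kOf[t]∣t : ∀ {t} → 1 ≤ t → 2 ^ kOf t ∣ t
2^kOf[t]∣t {t} 1≤t = proj₁ (kAux-exact t t 1≤t ≤-refl)

2^[1+kOf[t]]∤t : ∀ {t} → 1 ≤ t → 2 ^ suc (kOf t) ∤ t
2^[1+kOf[t]]∤t {t} 1≤t = proj₂ (kAux-exact t t 1≤t ≤-refl)

kOf≤⌈log₂⌉ : ∀ {t T} → 1 ≤ t → t ≤ T → kOf t ≤ ⌈log₂ T ⌉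
kOf≤⌈log₂⌉ {t} 1≤t t≤T = subst (_≤ _) (⌈log₂2^n⌉≡n (kOf t))
  (⌈log₂⌉-mono-≤ (≤-trans (∣⇒≤ {{>-nonZero 1≤t}} (2^kOf[t]∣t 1≤t)) t≤T))

lowBits : ℕ → ℕ → ℕ
lowBits t n = _%_ t (2 ^ n) {{m^n≢0 2 n}}

Φ : ℕ → ℕ → ℕ
Φ t zero    = 0
Φ t (suc n) = Φ t n + lowBits t n

private
  carry-shift : ∀ a n r → a + n + 1 + suc r ≡ a + r + suc n + 1
  carry-shift = solve-∀

Φ-suc-low : ∀ {t k} → 2 ^ k ∣ suc t → ∀ n → n ≤ suc k → Φ (suc t) n + 2 ^ n ≡ Φ t n + n + 1
Φ-suc-low _ zero _ = refl
Φ-suc-low {t} {k} 2^k∣1+t (suc n) n<1+k = begin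
  Φ (suc t) n + lowBits (suc t) n + 2 ^ suc n
    ≡⟨ cong (λ b → Φ (suc t) n + b + 2 ^ suc n) (n∣m⇒m%n≡0 (suc t) (2 ^ n) {{m^n≢0 2 n}} 2^n∣1+t) ⟩
  Φ (suc t) n + 0 + 2 * 2 ^ n
    ≡⟨ doubling (Φ (suc t) n) (2 ^ n) ⟩
  Φ (suc t) n + 2 ^ n + 2 ^ n
    ≡⟨ cong₂ _+_ (Φ-suc-low 2^k∣1+t n (<⇒≤ n<1+k))
                 (sym (∣1+m⇒1+m%n≡n t (2 ^ n) {{m^n≢0 2 n}} 2^n∣1+t)) ⟩
  Φ t n + n + 1 + suc (lowBits t n)
    ≡⟨ carry-shift (Φ t n) n (lowBits t n) ⟩
  Φ t n + lowBits t n + suc n + 1 ∎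
  where
  open ≡-Reasoning
  doubling : ∀ a p → a + 0 + 2 * p ≡ a + p + p
  doubling = solve-∀
  2^n∣1+t : 2 ^ n ∣ suc t
  2^n∣1+t = ∣-trans (^-monoʳ-∣ 2 (≤-pred n<1+k)) 2^k∣1+t

Φ-suc-high : ∀ {t k} → 2 ^ k ∣ suc t → 2 ^ suc k ∤ suc t →
             ∀ n → suc k ≤ n → Φ (suc t) n + 2 ^ suc k ≡ Φ t n + n + 1
Φ-suc-high {t} {k} 2^k∣1+t 2^1+k∤1+t (suc n) 1+k≤1+n with m≤n⇒m<n∨m≡n 1+k≤1+n
... | inj₂ refl = Φ-suc-low 2^k∣1+t (suc k) ≤-refl
... | inj₁ 1+k<1+n = begin
  Φ (suc t) n + lowBits (suc t) n + 2 ^ suc k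
    ≡⟨ cong (λ b → Φ (suc t) n + b + 2 ^ suc k) (∤1+m⇒[1+m]%n≡1+m%n t (2 ^ n) {{m^n≢0 2 n}} 2^n∤1+t) ⟩
  Φ (suc t) n + suc (lowBits t n) + 2 ^ suc k
    ≡⟨ xy∙z≈xz∙y (Φ (suc t) n) (suc (lowBits t n)) (2 ^ suc k) ⟩
  Φ (suc t) n + 2 ^ suc k + suc (lowBits t n)
    ≡⟨ cong (_+ suc (lowBits t n)) (Φ-suc-high 2^k∣1+t 2^1+k∤1+t n (≤-pred 1+k<1+n)) ⟩
  Φ t n + n + 1 + suc (lowBits t n)
    ≡⟨ carry-shift (Φ t n) n (lowBits t n) ⟩
  Φ t n + lowBits t n + suc n + 1 ∎
  where
  open ≡-Reasoning
  2^n∤1+t : 2 ^ n ∤ suc t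
  2^n∤1+t = 2^1+k∤1+t ∘ ∣-trans (^-monoʳ-∣ 2 (≤-pred 1+k<1+n))

Φ-suc : ∀ t n → suc (kOf (suc t)) ≤ n → Φ (suc t) n + 2 ^ suc (kOf (suc t)) ≡ Φ t n + n + 1
Φ-suc t = Φ-suc-high (2^kOf[t]∣t (s≤s z≤n)) (2^[1+kOf[t]]∤t (s≤s z≤n))

Φ-zero : ∀ n → Φ 0 n ≡ 0
Φ-zero zero    = refl
Φ-zero (suc n) = cong₂ _+_ (Φ-zero n) (n≤0⇒n≡0 (m%n≤m 0 (2 ^ n) {{m^n≢0 2 n}}))

n<2^n : ∀ n → n < 2 ^ n
n<2^n zero    = s≤s z≤n
n<2^n (suc n) = +-mono-≤ (m^n>0 2 n) (≤-trans (n<2^n n) (m≤m+n (2 ^ n) 0))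

rebuild-work : ∀ {Γ P ℓ k i} → 1 ≤ Γ → k < P → ℓ ≤ 2 * (2 * P) + 2 * (2 * P) → i ≤ Γ * ℓ →
               1 + (ℓ + k + 2) + i + (k + 2) + i ≤ 16 * Γ * (2 * P)
rebuild-work {Γ@(suc g)} {P@(suc p)} {ℓ} {k} {i} _ (s≤s k≤p) ℓ≤8P i≤Γℓ = begin
  1 + (ℓ + k + 2) + i + (k + 2) + i
    ≤⟨ +-mono-≤ (+-mono-≤ (+-mono-≤ (+-monoʳ-≤ 1 (+-monoˡ-≤ 2 (+-mono-≤ ℓ≤8P k≤P))) i≤Γ8P)
                          (+-monoˡ-≤ 2 k≤P))
                i≤Γ8P ⟩
  1 + (8P + P + 2) + Γ * 8P + (P + 2) + Γ * 8P
    ≤⟨ m≤m+n _ (1 + 16 * g + 6 * p + 16 * g * p) ⟩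
  1 + (8P + P + 2) + Γ * 8P + (P + 2) + Γ * 8P + (1 + 16 * g + 6 * p + 16 * g * p)
    ≡⟨ identity g p ⟩
  16 * Γ * (2 * P) ∎
  where
  open ≤-Reasoning
  8P : ℕ
  8P = 2 * (2 * P) + 2 * (2 * P)
  k≤P : k ≤ P
  k≤P = m≤n⇒m≤1+n k≤p
  i≤Γ8P : i ≤ Γ * 8P
  i≤Γ8P = ≤-trans i≤Γℓ (*-monoʳ-≤ Γ ℓ≤8P)
  identity : ∀ g p → let Γ = suc g; P = suc p; 8P = 2 * (2 * P) + 2 * (2 * P) in
             1 + (8P + P + 2) + Γ * 8P + (P + 2) + Γ * 8P + (1 + 16 * g + 6 * p + 16 * g * p) ≡ 16 * Γ * (2 * P)
  identity = solve-∀

length-insertSorted : ∀ x xs → length (insertSorted x xs) ≡ suc (length xs)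
length-insertSorted x []       = refl
length-insertSorted x (y ∷ ys) with x ≤ᵇ y
... | true  = refl
... | false = cong suc (length-insertSorted x ys)

length-sortYoung : ∀ xs → length (sortYoung xs) ≡ length xs
length-sortYoung []       = refl
length-sortYoung (x ∷ xs) = trans (length-insertSorted x (sortYoung xs)) (cong suc (length-sortYoung xs))

take++drop-take : ∀ {A : Set} {a b} (xs : List A) → a ≤ b → take a xs ++ drop a (take b xs) ≡ take b xs
take++drop-take {a = a} {b} xs a≤b = begin
  take a xs ++ drop a (take b xs)
    ≡⟨ cong (λ c → take c xs ++ drop a (take b xs)) (m≤n⇒m⊓n≡m a≤b) ⟨
  take (a ⊓ b) xs ++ drop a (take b xs)      ≡⟨ cong (_++ drop a (take b xs)) (take-take a b xs) ⟨
  take a (take b xs) ++ drop a (take b xs)   ≡⟨ take++drop≡id a (take b xs) ⟩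
  take b xs                                  ∎
  where open ≡-Reasoning

sizeBelow : (ℕ → List ℕ) → ℕ → ℕ
sizeBelow bs zero    = 0
sizeBelow bs (suc n) = sizeBelow bs n + length (bs n)

length-concat-map-upTo : ∀ bs n → length (concat (map bs (upTo n))) ≡ sizeBelow bs n
length-concat-map-upTo bs zero    = refl
length-concat-map-upTo bs (suc n) = begin
  length (concat (map bs (upTo (suc n))))              ≡⟨ cong (length ∘ concat ∘ map bs) (applyUpTo-∷ʳ id n) ⟨
  length (concat (map bs (upTo n ++ [ n ])))           ≡⟨ cong (length ∘ concat) (map-++ bs (upTo n) [ n ]) ⟩
  length (concat (map bs (upTo n) ++ [ bs n ]))        ≡⟨ cong length (concat-++ (map bs (upTo n)) [ bs n ]) ⟨
  length (concat (map bs (upTo n)) ++ bs n ++ [])      ≡⟨ length-++ (concat (map bs (upTo n))) ⟩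
  length (concat (map bs (upTo n))) + length (bs n ++ [])
    ≡⟨ cong₂ _+_ (length-concat-map-upTo bs n) (cong length (++-identityʳ (bs n))) ⟩
  sizeBelow bs n + length (bs n)                       ∎
  where open ≡-Reasoning

sizeBelow-empty : ∀ n → sizeBelow (λ _ → []) n ≡ 0
sizeBelow-empty zero    = refl
sizeBelow-empty (suc n) = trans (+-identityʳ _) (sizeBelow-empty n)

module Buckets (A : IncAlg) where
  open Procedure A

  afterUpdate : Update → (ℕ → List ℕ) → (ℕ → List ℕ)
  afterUpdate u bs = setB 0 (step2 u (bs 0)) bs

  merged : ℕ → Update → (ℕ → List ℕ) → List ℕ
  merged t u bs = sortYoung (unionUpTo (suc (kOf t)) (afterUpdate u bs))

  rebuilt : ℕ → Update → (ℕ → List ℕ) → (ℕ → List ℕ)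
  rebuilt t u bs = redistribute (kOf t) (merged t u bs) (afterUpdate u bs)

  length-removeYoungest : ∀ xs → length (removeYoungest xs) ≤ length xs
  length-removeYoungest xs with sortYoung xs | length-sortYoung xs
  ... | []     | _         = z≤n
  ... | _ ∷ ys | |sorted|≡ = ≤-trans (n≤1+n _) (≤-reflexive |sorted|≡)

  length-step2 : ∀ u xs → length (step2 u xs) ≤ suc (length xs)
  length-step2 (ins e) xs = ≤-refl
  length-step2 del     xs = m≤n⇒m≤1+n (length-removeYoungest xs)

  sizeBelow-setB0 : ∀ {xs bs} → length xs ≤ suc (length (bs 0)) →
                    ∀ n → sizeBelow (setB 0 xs bs) n ≤ suc (sizeBelow bs n)
  sizeBelow-setB0 _     zero          = z≤n
  sizeBelow-setB0 |xs|≤ (suc zero)    = |xs|≤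
  sizeBelow-setB0 |xs|≤ (suc (suc n)) = +-monoˡ-≤ _ (sizeBelow-setB0 |xs|≤ (suc n))

  redistribute-low : ∀ k L f j → j ≤ k → redistribute k L f j ≡ drop (2 ^ j ∸ 1) (take (2 ^ suc j ∸ 1) L)
  redistribute-low k L f j j≤k with j ≤ᵇ k | ≤⇒≤ᵇ j≤k
  ... | true | _ = refl

  redistribute-top : ∀ k L f → redistribute k L f (suc k) ≡ drop (2 ^ suc k ∸ 1) L
  redistribute-top k L f with suc k ≤ᵇ k | ≤ᵇ⇒≤ (suc k) k
  ... | true  | 1+k≤k = contradiction (1+k≤k _) (n≮n k)
  ... | false | _ with suc k ≡ᵇ suc k | ≡⇒≡ᵇ (suc k) (suc k) refl
  ...   | true | _ = refl

  redistribute-high : ∀ k L f j → suc k < j → redistribute k L f j ≡ f j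
  redistribute-high k L f j 1+k<j with j ≤ᵇ k | ≤ᵇ⇒≤ j k
  ... | true  | j≤k = contradiction (<-trans (n<1+n k) 1+k<j) (≤⇒≯ (j≤k _))
  ... | false | _ with j ≡ᵇ suc k | ≡ᵇ⇒≡ j (suc k)
  ...   | true  | j≡1+k = contradiction (j≡1+k _) (>⇒≢ 1+k<j)
  ...   | false | _ = refl

  sizeBelow-redistribute-low : ∀ k L f n → n ≤ suc k →
                               sizeBelow (redistribute k L f) n ≡ length (take (2 ^ n ∸ 1) L)
  sizeBelow-redistribute-low k L f zero    _      = refl
  sizeBelow-redistribute-low k L f (suc n) n<1+k = begin
    sizeBelow (redistribute k L f) n + length (redistribute k L f n)
      ≡⟨ cong₂ (λ a b → a + length b) (sizeBelow-redistribute-low k L f n (<⇒≤ n<1+k))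
                                      (redistribute-low k L f n (≤-pred n<1+k)) ⟩
    length (take (2 ^ n ∸ 1) L) + length (drop (2 ^ n ∸ 1) (take (2 ^ suc n ∸ 1) L))
      ≡⟨ length-++ (take (2 ^ n ∸ 1) L) ⟨
    length (take (2 ^ n ∸ 1) L ++ drop (2 ^ n ∸ 1) (take (2 ^ suc n ∸ 1) L))
      ≡⟨ cong length (take++drop-take L (∸-monoˡ-≤ 1 (m≤n*m (2 ^ n) 2))) ⟩
    length (take (2 ^ suc n ∸ 1) L) ∎
    where open ≡-Reasoning

  sizeBelow-redistribute-top : ∀ k L f → sizeBelow (redistribute k L f) (suc (suc k)) ≡ length L
  sizeBelow-redistribute-top k L f = begin
    sizeBelow (redistribute k L f) (suc k) + length (redistribute k L f (suc k))
      ≡⟨ cong₂ (λ a b → a + length b) (sizeBelow-redistribute-low k L f (suc k) ≤-refl)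
                                      (redistribute-top k L f) ⟩
    length (take (2 ^ suc k ∸ 1) L) + length (drop (2 ^ suc k ∸ 1) L)
      ≡⟨ length-++ (take (2 ^ suc k ∸ 1) L) ⟨
    length (take (2 ^ suc k ∸ 1) L ++ drop (2 ^ suc k ∸ 1) L)
      ≡⟨ cong length (take++drop≡id (2 ^ suc k ∸ 1) L) ⟩
    length L ∎
    where open ≡-Reasoning

  sizeBelow-redistribute-high : ∀ k L f → sizeBelow f (suc (suc k)) ≡ length L →
                                ∀ n → suc (suc k) ≤ n → sizeBelow (redistribute k L f) n ≡ sizeBelow f n
  sizeBelow-redistribute-high k L f |f|≡|L| (suc n) 2+k≤1+n with m≤n⇒m<n∨m≡n 2+k≤1+n
  ... | inj₂ refl      = trans (sizeBelow-redistribute-top k L f) (sym |f|≡|L|)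
  ... | inj₁ 2+k<1+n = cong₂ _+_ (sizeBelow-redistribute-high k L f |f|≡|L| n (≤-pred 2+k<1+n))
                                  (cong length (redistribute-high k L f n (≤-pred 2+k<1+n)))

  -- Since B_0, …, B_{n−1} were last rebuilt, to fewer than 2^n elements (at the latest when t was a
  -- multiple of 2^n), each update has added at most one element to them.
  BucketBound : ℕ → (ℕ → List ℕ) → Set
  BucketBound t bs = ∀ n → sizeBelow bs n ≤ 2 ^ n + lowBits t n

  sizeBelow-afterUpdate : ∀ u bs n → sizeBelow (afterUpdate u bs) n ≤ suc (sizeBelow bs n)
  sizeBelow-afterUpdate u bs = sizeBelow-setB0 (length-step2 u (bs 0))

  length-merged : ∀ t u bs → length (merged t u bs) ≡ sizeBelow (afterUpdate u bs) (suc (suc (kOf t)))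
  length-merged t u bs = trans (length-sortYoung (unionUpTo (suc (kOf t)) (afterUpdate u bs)))
                               (length-concat-map-upTo (afterUpdate u bs) (suc (suc (kOf t))))

  length-merged≤ : ∀ {t} t′ u bs → BucketBound t bs →
                   let n = suc (suc (kOf t′)) in length (merged t′ u bs) ≤ 2 ^ n + 2 ^ n
  length-merged≤ {t} t′ u bs bound = begin
    length (merged t′ u bs)                   ≡⟨ length-merged t′ u bs ⟩
    sizeBelow (afterUpdate u bs) n            ≤⟨ sizeBelow-afterUpdate u bs n ⟩
    suc (sizeBelow bs n)                      ≤⟨ s≤s (bound n) ⟩
    suc (2 ^ n + lowBits t n)                 ≡⟨ +-suc (2 ^ n) (lowBits t n) ⟨
    2 ^ n + suc (lowBits t n)                 ≤⟨ +-monoʳ-≤ (2 ^ n) (m%n<n t (2 ^ n) {{m^n≢0 2 n}}) ⟩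
    2 ^ n + 2 ^ n                             ∎
    where
    open ≤-Reasoning
    n : ℕ
    n = suc (suc (kOf t′))

  rebuilt-low : ∀ t u bs n → n ≤ suc (kOf t) → sizeBelow (rebuilt t u bs) n ≤ 2 ^ n
  rebuilt-low t u bs n n≤1+k = begin
    sizeBelow (rebuilt t u bs) n              ≡⟨ sizeBelow-redistribute-low (kOf t) L (afterUpdate u bs) n n≤1+k ⟩
    length (take (2 ^ n ∸ 1) L)               ≡⟨ length-take (2 ^ n ∸ 1) L ⟩
    (2 ^ n ∸ 1) ⊓ length L                    ≤⟨ m⊓n≤m (2 ^ n ∸ 1) (length L) ⟩
    2 ^ n ∸ 1                                 ≤⟨ m∸n≤m (2 ^ n) 1 ⟩
    2 ^ n                                     ∎
    where
    open ≤-Reasoning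
    L : List ℕ
    L = merged t u bs

  rebuilt-high : ∀ t u bs n → suc (kOf t) < n → sizeBelow (rebuilt t u bs) n ≡ sizeBelow (afterUpdate u bs) n
  rebuilt-high t u bs = sizeBelow-redistribute-high (kOf t) (merged t u bs) (afterUpdate u bs)
                                                    (sym (length-merged t u bs))

  rebuilt-bound : ∀ t u bs → BucketBound t bs → BucketBound (suc t) (rebuilt (suc t) u bs)
  rebuilt-bound t u bs bound n with n ≤? suc (kOf (suc t))
  ... | yes n≤1+k = ≤-trans (rebuilt-low (suc t) u bs n n≤1+k) (m≤m+n (2 ^ n) (lowBits (suc t) n))
  ... | no n≰1+k = begin
    sizeBelow (rebuilt (suc t) u bs) n        ≡⟨ rebuilt-high (suc t) u bs n (≰⇒> n≰1+k) ⟩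
    sizeBelow (afterUpdate u bs) n            ≤⟨ sizeBelow-afterUpdate u bs n ⟩
    suc (sizeBelow bs n)                      ≤⟨ s≤s (bound n) ⟩
    suc (2 ^ n + lowBits t n)                 ≡⟨ +-suc (2 ^ n) (lowBits t n) ⟨
    2 ^ n + suc (lowBits t n)
      ≡⟨ cong (2 ^ n +_) (∤1+m⇒[1+m]%n≡1+m%n t (2 ^ n) {{m^n≢0 2 n}} 2^n∤1+t) ⟨
    2 ^ n + lowBits (suc t) n                 ∎
    where
    open ≤-Reasoning
    2^n∤1+t : 2 ^ n ∤ suc t
    2^n∤1+t = 2^[1+kOf[t]]∤t (s≤s z≤n) ∘ ∣-trans (^-monoʳ-∣ 2 (<⇒≤ (≰⇒> n≰1+k)))

module Accounting (A : IncAlg) where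
  open IncAlg A
  open Procedure A
  open Buckets A

  Outcome : Set
  Outcome = State × (List LogEntry × ℕ)

  logOf : Outcome → List LogEntry
  logOf = proj₁ ∘ proj₂

  timeOf : Outcome → ℕ
  timeOf = proj₂ ∘ proj₂

  logCost : List LogEntry → ℕ
  logCost []                  = 0
  logCost ((_ , (_ , c)) ∷ l) = c + logCost l

  rewind-logCost : ∀ j s l → logCost l ≡ timeOf (rewind j s l) + logCost (logOf (rewind j s l))
  rewind-logCost j s [] = refl
  rewind-logCost j s ((i , (s₀ , c)) ∷ l) with i ≤ᵇ j
  ... | true  = trans (cong (c +_) (rewind-logCost j s₀ l)) (sym (+-assoc c _ _))
  ... | false = refl

  insertBucket-logCost : ∀ i es s l →
    logCost (logOf (insertBucket i es s l)) ≡ logCost l + timeOf (insertBucket i es s l)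
  insertBucket-logCost i []       s l = sym (+-identityʳ (logCost l))
  insertBucket-logCost i (e ∷ es) s l = begin
    logCost (logOf r)                   ≡⟨ insertBucket-logCost i es (insert s e) ((i , (s , cost s e)) ∷ l) ⟩
    cost s e + logCost l + timeOf r     ≡⟨ cong (_+ timeOf r) (+-comm (cost s e) (logCost l)) ⟩
    logCost l + cost s e + timeOf r     ≡⟨ +-assoc (logCost l) (cost s e) (timeOf r) ⟩
    logCost l + (cost s e + timeOf r)   ∎
    where
    open ≡-Reasoning
    r : Outcome
    r = insertBucket i es (insert s e) ((i , (s , cost s e)) ∷ l)

  insertDown-logCost : ∀ n f s l →
    logCost (logOf (insertDown n f s l)) ≡ logCost l + timeOf (insertDown n f s l)
  insertDown-logCost zero    f s l = insertBucket-logCost zero (f zero) s l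
  insertDown-logCost (suc n) f s l = begin
    logCost (logOf r₂)                        ≡⟨ insertDown-logCost n f (proj₁ r₁) (logOf r₁) ⟩
    logCost (logOf r₁) + timeOf r₂
      ≡⟨ cong (_+ timeOf r₂) (insertBucket-logCost (suc n) (f (suc n)) s l) ⟩
    logCost l + timeOf r₁ + timeOf r₂         ≡⟨ +-assoc (logCost l) (timeOf r₁) (timeOf r₂) ⟩
    logCost l + (timeOf r₁ + timeOf r₂)       ∎
    where
    open ≡-Reasoning
    r₁ r₂ : Outcome
    r₁ = insertBucket (suc n) (f (suc n)) s l
    r₂ = insertDown n f (proj₁ r₁) (logOf r₁)

  module Amortised {Γ : ℕ} (cost≤Γ : ∀ s e → cost s e ≤ Γ) where

    insertBucket-time : ∀ i es s l → timeOf (insertBucket i es s l) ≤ Γ * length es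
    insertBucket-time i []       s l = z≤n
    insertBucket-time i (e ∷ es) s l = begin
      cost s e + timeOf (insertBucket i es (insert s e) ((i , (s , cost s e)) ∷ l))
        ≤⟨ +-mono-≤ (cost≤Γ s e) (insertBucket-time i es (insert s e) ((i , (s , cost s e)) ∷ l)) ⟩
      Γ + Γ * length es  ≡⟨ *-suc Γ (length es) ⟨
      Γ * suc (length es) ∎
      where open ≤-Reasoning

    insertDown-time : ∀ n f s l → timeOf (insertDown n f s l) ≤ Γ * sizeBelow f (suc n)
    insertDown-time zero    f s l = insertBucket-time zero (f zero) s l
    insertDown-time (suc n) f s l = begin
      timeOf r₁ + timeOf r₂
        ≤⟨ +-mono-≤ (insertBucket-time (suc n) (f (suc n)) s l) (insertDown-time n f (proj₁ r₁) (logOf r₁)) ⟩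
      Γ * length (f (suc n)) + Γ * sizeBelow f (suc n)   ≡⟨ *-distribˡ-+ Γ (length (f (suc n))) _ ⟨
      Γ * (length (f (suc n)) + sizeBelow f (suc n))     ≡⟨ cong (Γ *_) (+-comm (length (f (suc n))) _) ⟩
      Γ * sizeBelow f (suc (suc n))                      ∎
      where
      open ≤-Reasoning
      r₁ r₂ : Outcome
      r₁ = insertBucket (suc n) (f (suc n)) s l
      r₂ = insertDown n f (proj₁ r₁) (logOf r₁)

    potential : ℕ → ℕ → Config → ℕ
    potential M t c = logCost (Config.log c) + 16 * Γ * Φ t M

    step-cost : 1 ≤ Γ → ∀ t u c → BucketBound t (Config.buckets c) →
      let c′ = step (suc t) u c in
      Config.spent c′ + logCost (Config.log c′)
        ≤ Config.spent c + logCost (Config.log c) + 16 * Γ * 2 ^ suc (kOf (suc t))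
    step-cost 1≤Γ t u (config bs s l sp) bound = begin
      sp + r + 1 + (length L + k + 2) + i + (k + 2) + logCost (logOf r₄)
        ≡⟨ cong (sp + r + 1 + (length L + k + 2) + i + (k + 2) +_)
                (insertDown-logCost (suc k) (rebuilt (suc t) u bs) (proj₁ r₁) (logOf r₁)) ⟩
      sp + r + 1 + (length L + k + 2) + i + (k + 2) + (logCost (logOf r₁) + i)
        ≡⟨ regroup sp r (logCost (logOf r₁)) (length L) k i ⟩
      sp + (r + logCost (logOf r₁)) + work
        ≡⟨ cong (λ x → sp + x + work) (rewind-logCost (suc k) s l) ⟨
      sp + logCost l + work
        ≤⟨ +-monoʳ-≤ (sp + logCost l)
                     (rebuild-work 1≤Γ (n<2^n k) (length-merged≤ (suc t) u bs bound) i≤Γ|L|) ⟩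
      sp + logCost l + 16 * Γ * 2 ^ suc k ∎
      where
      open ≤-Reasoning
      k : ℕ
      k = kOf (suc t)
      L : List ℕ
      L = merged (suc t) u bs
      r₁ r₄ : Outcome
      r₁ = rewind (suc k) s l
      r₄ = insertDown (suc k) (rebuilt (suc t) u bs) (proj₁ r₁) (logOf r₁)
      r i : ℕ
      r = timeOf r₁
      i = timeOf r₄
      work : ℕ
      work = 1 + (length L + k + 2) + i + (k + 2) + i
      i≤Γ|L| : i ≤ Γ * length L
      i≤Γ|L| = ≤-trans (insertDown-time (suc k) (rebuilt (suc t) u bs) (proj₁ r₁) (logOf r₁))
                       (≤-reflexive (cong (Γ *_) (sizeBelow-redistribute-top k L (afterUpdate u bs))))
      regroup : ∀ sp r ρ ℓ k i → sp + r + 1 + (ℓ + k + 2) + i + (k + 2) + (ρ + i)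
                                 ≡ sp + (r + ρ) + (1 + (ℓ + k + 2) + i + (k + 2) + i)
      regroup = solve-∀

    step-amortised : 1 ≤ Γ → ∀ M t u c → kOf (suc t) < M → BucketBound t (Config.buckets c) →
      Config.spent (step (suc t) u c) + potential M (suc t) (step (suc t) u c)
        ≤ Config.spent c + potential M t c + 16 * Γ * suc M
    step-amortised 1≤Γ M t u c k<M bound = begin
      Config.spent c′ + (logCost (Config.log c′) + 16 * Γ * Φ (suc t) M)
        ≡⟨ +-assoc (Config.spent c′) (logCost (Config.log c′)) _ ⟨
      Config.spent c′ + logCost (Config.log c′) + 16 * Γ * Φ (suc t) M
        ≤⟨ +-monoˡ-≤ (16 * Γ * Φ (suc t) M) (step-cost 1≤Γ t u c bound) ⟩
      a + 16 * Γ * 2 ^ suc k + 16 * Γ * Φ (suc t) M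
        ≡⟨ factor a (16 * Γ) (2 ^ suc k) (Φ (suc t) M) ⟩
      a + 16 * Γ * (Φ (suc t) M + 2 ^ suc k)
        ≡⟨ cong (λ x → a + 16 * Γ * x) (Φ-suc t M k<M) ⟩
      a + 16 * Γ * (Φ t M + M + 1)
        ≡⟨ unfactor (Config.spent c) (logCost (Config.log c)) (16 * Γ) (Φ t M) M ⟩
      Config.spent c + potential M t c + 16 * Γ * suc M ∎
      where
      open ≤-Reasoning
      k : ℕ
      k = kOf (suc t)
      c′ : Config
      c′ = step (suc t) u c
      a : ℕ
      a = Config.spent c + logCost (Config.log c)
      factor : ∀ a c x y → a + c * x + c * y ≡ a + c * (y + x)
      factor = solve-∀
      unfactor : ∀ sp ℓ c φ M → sp + ℓ + c * (φ + M + 1) ≡ sp + (ℓ + c * φ) + c * suc M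
      unfactor = solve-∀

    runFrom-amortised : 1 ≤ Γ → ∀ {M T} → (∀ {t′} → 1 ≤ t′ → t′ ≤ T → kOf t′ < M) →
      ∀ us t c → t + length us ≤ T → BucketBound t (Config.buckets c) →
      Config.spent (runFrom (suc t) us c) + potential M (t + length us) (runFrom (suc t) us c)
        ≤ Config.spent c + potential M t c + length us * (16 * Γ * suc M)
    runFrom-amortised 1≤Γ {M} levels [] t c _ _ rewrite +-identityʳ t =
      m≤m+n (Config.spent c + potential M t c) 0
    runFrom-amortised 1≤Γ {M} {T} levels (u ∷ us) t c t+|u∷us|≤T bound = begin
      Config.spent c″ + potential M (t + suc (length us)) c″
        ≡⟨ cong (λ t″ → Config.spent c″ + potential M t″ c″) (+-suc t (length us)) ⟩
      Config.spent c″ + potential M (suc t + length us) c″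
        ≤⟨ runFrom-amortised 1≤Γ levels us (suc t) c′ (subst (_≤ T) (+-suc t (length us)) t+|u∷us|≤T)
                             (rebuilt-bound t u (Config.buckets c) bound) ⟩
      Config.spent c′ + potential M (suc t) c′ + length us * W
        ≤⟨ +-monoˡ-≤ (length us * W) (step-amortised 1≤Γ M t u c (levels (s≤s z≤n) 1+t≤T) bound) ⟩
      Config.spent c + potential M t c + W + length us * W
        ≡⟨ +-assoc (Config.spent c + potential M t c) W (length us * W) ⟩
      Config.spent c + potential M t c + suc (length us) * W ∎
      where
      open ≤-Reasoning
      W : ℕ
      W = 16 * Γ * suc M
      c′ c″ : Config
      c′ = step (suc t) u c
      c″ = runFrom (suc (suc t)) us c′
      1+t≤T : suc t ≤ T
      1+t≤T = ≤-trans (m<m+n t z<s) t+|u∷us|≤T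

    totalTime≤ : 1 ≤ Γ → ∀ us → totalTime us ≤ length us * (16 * Γ * suc (suc ⌈log₂ length us ⌉))
    totalTime≤ 1≤Γ us = begin
      totalTime us                                         ≤⟨ m≤m+n (totalTime us) _ ⟩
      Config.spent final + potential M N final
        ≤⟨ runFrom-amortised 1≤Γ (λ 1≤t t≤T → s≤s (kOf≤⌈log₂⌉ 1≤t t≤T)) us 0 initConfig ≤-refl
                             (λ n → subst (_≤ 2 ^ n + lowBits 0 n) (sym (sizeBelow-empty n)) z≤n) ⟩
      0 + (0 + 16 * Γ * Φ 0 M) + N * (16 * Γ * suc M)
        ≡⟨ cong (λ φ → 16 * Γ * φ + N * (16 * Γ * suc M)) (Φ-zero M) ⟩
      16 * Γ * 0 + N * (16 * Γ * suc M)
        ≡⟨ cong (_+ N * (16 * Γ * suc M)) (*-zeroʳ (16 * Γ)) ⟩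
      N * (16 * Γ * suc M)                                 ∎
      where
      open ≤-Reasoning
      N M : ℕ
      N = length us
      M = suc ⌈log₂ N ⌉
      final : Config
      final = runFrom 1 us initConfig

log-slack : ∀ Γ T m → T * (16 * Γ * suc (suc m)) ≤ 32 * T * (Γ * (m + 1))
log-slack Γ T m = ≤-trans (m≤m+n _ (16 * Γ * T * m)) (≤-reflexive (identity Γ T m))
  where
  identity : ∀ Γ T m → T * (16 * Γ * suc (suc m)) + 16 * Γ * T * m ≡ 32 * T * (Γ * (m + 1))
  identity = solve-∀

lemma2p2 : ∃[ C ] ((A : IncAlg) (Γu : ℕ) → 1 ≤ Γu
         → (∀ s e → IncAlg.cost A s e ≤ Γu)
         → (us : List Update) → Unique (insKeys us)
         → Procedure.totalTime A us
           ≤ C * length us * (Γu * (⌈log₂ length us ⌉ + 1)))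
lemma2p2 = 32 , λ A Γu 1≤Γu cost≤Γu us _ →
  ≤-trans (Accounting.Amortised.totalTime≤ A cost≤Γu 1≤Γu us) (log-slack Γu (length us) ⌈log₂ length us ⌉)
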